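{- Let $G$ be a connected graph with girth at least $5$ and minimum degree at least $2$. If $G$ has $n$ vertices and chromatic number $\chi(G)$, then $meg(G)\leq n\left(\frac{\chi(G)-1}{\chi(G)}\right)$.
   Context: All graphs are finite and simple. The girth of a graph is the length of its shortest cycle. A pair of vertices $u,v$ (or any vertex set containing them) monitors an edge $e$ if $e$ lies on every shortest $u$–$v$ path. A monitoring edge-geodetic set (MEG-set) of $G$ is a set $M\subseteq V(G)$ such that every edge of $G$ is monitored by some pair of vertices of $M$; $meg(G)$ is the minimum size of an MEG-set. -}

module Defs where

open import Data.Nat using (ℕ; zero; suc; _≤_; _+_)
open import Data.Fin using (Fin; inject₁; fromℕ) renaming (zero to fzero; suc to fsuc)
open import Data.Fin.Subset using (Subset; _∈_)
open import Data.List using (length; filter)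
open import Data.List.Base using ()
open import Data.Fin.Base using ()
open import Data.List using (List)
open import Data.Product using (Σ; ∃; _×_; _,_)
open import Data.Sum using (_⊎_)
open import Relation.Nullary using (¬_)
open import Relation.Unary using (Pred)
open import Relation.Binary using (Decidable)
open import Relation.Binary.PropositionalEquality using (_≡_)
open import Function.Definitions using (Injective)
open import Data.Vec.Functional using ()
import Data.List as L
import Data.Fin as F

record Graph (n : ℕ) : Set₁ where
  field
    Adj    : Fin n → Fin n → Set
    adj?   : Decidable Adj
    sym    : ∀ {u v} → Adj u v → Adj v u
    irrefl : ∀ {u} → ¬ Adj u u

module _ {n : ℕ} (G : Graph n) where
  open Graph G

  degree : Fin n → ℕ
  degree v = length (filter (adj? v) (L.allFin n))

  MinDegreeAtLeast : ℕ → Set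
  MinDegreeAtLeast d = ∀ v → d ≤ degree v

  data Walk : Fin n → Fin n → ℕ → Set where
    nil  : ∀ {u} → Walk u u 0
    cons : ∀ {u w v k} → Adj u w → Walk w v k → Walk u v (suc k)

  Connected : Set
  Connected = ∀ u v → ∃ λ k → Walk u v k

  UsesEdge : Fin n → Fin n → ∀ {u v k} → Walk u v k → Set
  UsesEdge a b nil = Data.Empty.⊥
    where import Data.Empty
  UsesEdge a b (cons {u} {w} _ p) =
    ((u ≡ a) × (w ≡ b)) ⊎ (((u ≡ b) × (w ≡ a)) ⊎ UsesEdge a b p)

  Shortest : ∀ {u v k} → Walk u v k → Set
  Shortest {u} {v} {k} p = ∀ k' → Walk u v k' → k ≤ k'

  Monitors : Fin n → Fin n → Fin n → Fin n → Set
  Monitors u v a b = ∀ k (p : Walk u v k) → Shortest p → UsesEdge a b p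

  IsMEGSet : Subset n → Set
  IsMEGSet M = ∀ a b → Adj a b →
    Σ (Fin n) λ u → Σ (Fin n) λ v → (u ∈ M) × ((v ∈ M) × Monitors u v a b)

  -- a cycle of length m+3: injective cyclic sequence of adjacent vertices
  Cycle : ℕ → Set
  Cycle m = Σ (Fin (suc (suc (suc m))) → Fin n) λ c →
    Injective _≡_ _≡_ c ×
    ((∀ (i : Fin (suc (suc m))) → Adj (c (inject₁ i)) (c (fsuc i))) ×
     Adj (c (fromℕ (suc (suc m)))) (c fzero))

  -- girth ≥ g: every cycle has length ≥ g (vacuous for acyclic graphs)
  GirthAtLeast : ℕ → Set
  GirthAtLeast g = ∀ m → Cycle m → g ≤ 3 + m

  Colorable : ℕ → Set
  Colorable k = Σ (Fin n → Fin k) λ col → ∀ u v → Adj u v → ¬ (col u ≡ col v)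

  IsChromaticNumber : ℕ → Set
  IsChromaticNumber k = Colorable k × (∀ j → Colorable j → k ≤ j)

{-# OPTIONS --safe #-}
-- Let I be a largest colour class of a proper χ-colouring, so that χ ∣I∣ ≥ n; it suffices
-- that the complement of an independent set I is an MEG-set. An edge with both ends
-- outside I is monitored by its ends. An edge ab with b ∈ I is monitored by a and a
-- second neighbour d of b (it exists as δ ≥ 2, and d ∉ I): since G has no triangle and
-- no 4-cycle, a–b–d is the only shortest a–d path.
module Submission where

open import Defs
open import Data.Nat using (ℕ; _≤_; _*_; _∸_)
open import Data.Fin.Subset using (Subset; ∣_∣)
open import Data.Product using (Σ; _×_)

open import Data.Bool.Base using (Bool; true; false)
open import Data.Fin.Base using (Fin; zero; suc; inject₁; fromℕ)
open import Data.Fin.Properties using (_≟_; ¬Fin0)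
open import Data.Fin.Subset using (_∈_; _∉_; ∁; ⊥; inside; outside)
open import Data.Fin.Subset.Properties using (_∈?_; x∉p⇒x∈∁p; ∣∁p∣≡n∸∣p∣)
open import Data.List.Base using (List; []; _∷_; length; allFin)
open import Data.List.Membership.Propositional using () renaming (_∈_ to _∈ₗ_)
open import Data.List.Membership.Propositional.Properties using (∈-filter⁻)
open import Data.List.Relation.Unary.All using ([]; _∷_)
open import Data.List.Relation.Unary.AllPairs using ([]; _∷_)
open import Data.List.Relation.Unary.Any using (here; there)
import Data.List.Relation.Unary.Unique.Propositional as List
import Data.List.Relation.Unary.Unique.Propositional.Properties as List
open import Data.Nat.Base using (zero; suc; _+_; z≤n; s≤s)
open import Data.Nat.Properties
  using ( +-0-commutativeMonoid; _≤?_; ≤-refl; ≤-trans; <⇒≤; ≰⇒>; +-mono-≤; +-monoʳ-≤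
        ; *-monoʳ-≤; *-comm; *-suc; *-zeroʳ; *-distribʳ-∸; ∸-monoʳ-≤; m+n∸m≡n
        ; module ≤-Reasoning)
open import Algebra.Properties.CommutativeMonoid.Sum +-0-commutativeMonoid
  using (sum-syntax; sum-cong-≗; sum-replicate-zero; ∑-distrib-+)
open import Data.Product using (∃; ∃₂; _,_; proj₂)
open import Data.Sum using (inj₁; inj₂)
open import Data.Vec.Base using (Vec; []; _∷_; lookup; tabulate)
open import Data.Vec.Properties using ([]=⇒lookup; lookup∘tabulate)
open import Data.Vec.Relation.Unary.All using ([]; _∷_)
open import Data.Vec.Relation.Unary.AllPairs using ([]; _∷_)
import Data.Vec.Relation.Unary.Unique.Propositional as Vec
import Data.Vec.Relation.Unary.Unique.Propositional.Properties as Vec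
open import Function.Base using (_∘_)
open import Relation.Binary.PropositionalEquality
  using (_≡_; _≢_; refl; sym; trans; cong; cong₂; subst; module ≡-Reasoning)
open import Relation.Nullary using (¬_; yes; no; does; contradiction)

indicator : Bool → ℕ
indicator true  = 1
indicator false = 0

∣x∷p∣≡indicator[x]+∣p∣ : ∀ {n} x (p : Subset n) → ∣ x ∷ p ∣ ≡ indicator x + ∣ p ∣
∣x∷p∣≡indicator[x]+∣p∣ outside p = refl
∣x∷p∣≡indicator[x]+∣p∣ inside  p = refl

∑-indicator-≟ : ∀ {k} (x : Fin k) → ∑[ c < k ] indicator (does (x ≟ c)) ≡ 1
∑-indicator-≟ {suc k} zero    = cong suc (sum-replicate-zero k)
∑-indicator-≟ {suc k} (suc x) = ∑-indicator-≟ x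

fibre : ∀ {n k} → (Fin n → Fin k) → Fin k → Subset n
fibre f c = tabulate (λ v → does (f v ≟ c))

∈-fibre⁻ : ∀ {n k} (f : Fin n → Fin k) {c v} → v ∈ fibre f c → f v ≡ c
∈-fibre⁻ f {c} {v} v∈fibre
  with f v ≟ c | trans (sym ([]=⇒lookup v∈fibre)) (lookup∘tabulate (λ v → does (f v ≟ c)) v)
... | yes fv≡c | _ = fv≡c
... | no _     | ()

∑-∣fibre∣ : ∀ {n k} (f : Fin n → Fin k) → ∑[ c < k ] ∣ fibre f c ∣ ≡ n
∑-∣fibre∣ {zero}  {k} f = sum-replicate-zero k
∑-∣fibre∣ {suc n} {k} f = begin
  ∑[ c < k ] ∣ fibre f c ∣
    ≡⟨ sum-cong-≗ (λ c → ∣x∷p∣≡indicator[x]+∣p∣ (hit c) (fibre (f ∘ suc) c)) ⟩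
  ∑[ c < k ] (indicator (hit c) + ∣ fibre (f ∘ suc) c ∣)
    ≡⟨ ∑-distrib-+ (indicator ∘ hit) (λ c → ∣ fibre (f ∘ suc) c ∣) ⟩
  ∑[ c < k ] indicator (hit c) + ∑[ c < k ] ∣ fibre (f ∘ suc) c ∣
    ≡⟨ cong₂ _+_ (∑-indicator-≟ (f zero)) (∑-∣fibre∣ (f ∘ suc)) ⟩
  suc n
    ∎
  where
    open ≡-Reasoning
    hit : Fin k → Bool
    hit c = does (f zero ≟ c)

∃-≥-average : ∀ k (f : Fin (suc k) → ℕ) → ∃ λ c → ∑[ i < suc k ] f i ≤ suc k * f c
∃-≥-average zero    f = zero , ≤-refl
∃-≥-average (suc k) f with ∃-≥-average k (f ∘ suc)
... | c , ∑≤ with f zero ≤? f (suc c)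
...   | yes f₀≤ = suc c , +-mono-≤ f₀≤ ∑≤
...   | no  f₀≰ = zero , +-monoʳ-≤ (f zero) (≤-trans ∑≤ (*-monoʳ-≤ (suc k) (<⇒≤ (≰⇒> f₀≰))))

m≤[1+k]*s⇒[m∸s]*[1+k]≤m*k : ∀ {m s} k → m ≤ suc k * s → (m ∸ s) * suc k ≤ m * k
m≤[1+k]*s⇒[m∸s]*[1+k]≤m*k {m} {s} k m≤ = begin
  (m ∸ s) * suc k       ≡⟨ *-distribʳ-∸ (suc k) m s ⟩
  m * suc k ∸ s * suc k ≡⟨ cong (m * suc k ∸_) (*-comm s (suc k)) ⟩
  m * suc k ∸ suc k * s ≤⟨ ∸-monoʳ-≤ (m * suc k) m≤ ⟩
  m * suc k ∸ m         ≡⟨ cong (_∸ m) (*-suc m k) ⟩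
  m + m * k ∸ m         ≡⟨ m+n∸m≡n m (m * k) ⟩
  m * k                 ∎
  where open ≤-Reasoning

∃-small-∁fibre : ∀ {n k} (f : Fin n → Fin (suc k)) → ∃ λ c → ∣ ∁ (fibre f c) ∣ * suc k ≤ n * k
∃-small-∁fibre {n} {k} f with ∃-≥-average k (λ c → ∣ fibre f c ∣)
... | c , ∑≤ = c , (begin
  ∣ ∁ (fibre f c) ∣ * suc k   ≡⟨ cong (_* suc k) (∣∁p∣≡n∸∣p∣ (fibre f c)) ⟩
  (n ∸ ∣ fibre f c ∣) * suc k ≤⟨ m≤[1+k]*s⇒[m∸s]*[1+k]≤m*k k n≤ ⟩
  n * k                       ∎)
  where
    open ≤-Reasoning
    n≤ : n ≤ suc k * ∣ fibre f c ∣
    n≤ = subst (_≤ suc k * ∣ fibre f c ∣) (∑-∣fibre∣ f) ∑≤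

∃-distinct-pair : ∀ {A : Set} {xs : List A} → List.Unique xs → 2 ≤ length xs →
                  ∃₂ λ x y → x ≢ y × x ∈ₗ xs × y ∈ₗ xs
∃-distinct-pair {xs = x ∷ y ∷ _} ((x≢y ∷ _) ∷ _) _       = x , y , x≢y , here refl , there (here refl)
∃-distinct-pair {xs = _ ∷ []}    _                 (s≤s ())

module _ {n : ℕ} (G : Graph n) where
  open Graph G renaming (sym to Adj-sym)

  Adj⇒≢ : ∀ {a b} → Adj a b → a ≢ b
  Adj⇒≢ ab refl = irrefl ab

  cycle : ∀ {m} (vs : Vec (Fin n) (3 + m)) → Vec.Unique vs →
          (∀ i → Adj (lookup vs (inject₁ i)) (lookup vs (suc i))) →
          Adj (lookup vs (fromℕ (2 + m))) (lookup vs zero) → Cycle G m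
  cycle vs unique steps closing =
    lookup vs , (λ {i j} → Vec.lookup-injective unique i j) , steps , closing

  no-triangle : GirthAtLeast G 5 → ∀ {a b c} → Adj a b → Adj b c → ¬ Adj c a
  no-triangle girth {a} {b} {c} ab bc ca =
    contradiction (girth 0 (cycle (a ∷ b ∷ c ∷ []) distinct (λ { zero → ab ; (suc zero) → bc }) ca))
                  λ { (s≤s (s≤s (s≤s ()))) }
    where

      distinct : Vec.Unique (a ∷ b ∷ c ∷ [])
      distinct = (Adj⇒≢ ab ∷ Adj⇒≢ (Adj-sym ca) ∷ []) ∷ (Adj⇒≢ bc ∷ []) ∷ [] ∷ []

  no-square : GirthAtLeast G 5 → ∀ {a b c d} → a ≢ c → b ≢ d →
              Adj a b → Adj b c → Adj c d → ¬ Adj d a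
  no-square girth {a} {b} {c} {d} a≢c b≢d ab bc cd da =
    contradiction (girth 1 (cycle (a ∷ b ∷ c ∷ d ∷ []) distinct
                                  (λ { zero → ab ; (suc zero) → bc ; (suc (suc zero)) → cd }) da))
                  λ { (s≤s (s≤s (s≤s (s≤s ())))) }
    where

      distinct : Vec.Unique (a ∷ b ∷ c ∷ d ∷ [])
      distinct = (Adj⇒≢ ab ∷ a≢c ∷ Adj⇒≢ (Adj-sym da) ∷ [])
               ∷ (Adj⇒≢ bc ∷ b≢d ∷ [])
               ∷ (Adj⇒≢ cd ∷ [])
               ∷ [] ∷ []

  usesEdge-sym : ∀ {a b u v k} {p : Walk G u v k} → UsesEdge G a b p → UsesEdge G b a p
  usesEdge-sym {p = cons _ _} (inj₁ uses)        = inj₂ (inj₁ uses)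
  usesEdge-sym {p = cons _ _} (inj₂ (inj₁ uses)) = inj₁ uses
  usesEdge-sym {p = cons _ _} (inj₂ (inj₂ uses)) = inj₂ (inj₂ (usesEdge-sym uses))

  edge-monitors : ∀ {a b} → Adj a b → Monitors G a b a b
  edge-monitors ab _ nil                _        = contradiction ab irrefl
  edge-monitors ab _ (cons _ nil)       _        = inj₁ (refl , refl)
  edge-monitors ab _ (cons _ (cons _ _)) shortest =
    contradiction (shortest 1 (cons ab nil)) λ { (s≤s ()) }

  path₂-monitors : GirthAtLeast G 5 → ∀ {a b c} → Adj a b → Adj b c → a ≢ c → Monitors G a c a b
  path₂-monitors girth ab bc a≢c _ nil _ = contradiction refl a≢c
  path₂-monitors girth ab bc a≢c _ (cons ac nil) _ =
    contradiction (Adj-sym ac) (no-triangle girth ab bc)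
  path₂-monitors girth {b = b} ab bc a≢c _ (cons {w = w} aw (cons wc nil)) _ with w ≟ b
  ... | yes refl = inj₁ (refl , refl)
  ... | no  w≢b  = contradiction (Adj-sym aw) (no-square girth a≢c (w≢b ∘ sym) ab bc (Adj-sym wc))
  path₂-monitors girth ab bc a≢c _ (cons _ (cons _ (cons _ _))) shortest =
    contradiction (shortest 2 (cons ab (cons bc nil))) λ { (s≤s (s≤s ())) }

  another-neighbour : MinDegreeAtLeast G 2 → ∀ a b → ∃ λ d → Adj a d × d ≢ b
  another-neighbour δ≥2 a b
    with ∃-distinct-pair (List.filter⁺ (adj? a) (List.allFin⁺ n)) (δ≥2 a)
  ... | x , y , x≢y , x∈ , y∈ with x ≟ b
  ...   | no  x≢b  = x , proj₂ (∈-filter⁻ (adj? a) {xs = allFin n} x∈) , x≢b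
  ...   | yes refl = y , proj₂ (∈-filter⁻ (adj? a) {xs = allFin n} y∈) , x≢y ∘ sym

  Independent : Subset n → Set
  Independent I = ∀ {u v} → Adj u v → u ∈ I → v ∉ I

  Monitored : Subset n → Fin n → Fin n → Set
  Monitored M a b = Σ (Fin n) λ u → Σ (Fin n) λ v → u ∈ M × v ∈ M × Monitors G u v a b

  monitored-sym : ∀ {M a b} → Monitored M a b → Monitored M b a
  monitored-sym (u , v , u∈M , v∈M , monitors) =
    u , v , u∈M , v∈M , λ k p shortest → usesEdge-sym (monitors k p shortest)

  edge-into-independent-monitored : GirthAtLeast G 5 → MinDegreeAtLeast G 2 →
                                    ∀ {I} → Independent I →
                                    ∀ {a b} → Adj a b → a ∉ I → b ∈ I → Monitored (∁ I) a b
  edge-into-independent-monitored girth δ≥2 independent {a} {b} ab a∉I b∈I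
    with another-neighbour δ≥2 b a
  ... | d , bd , d≢a = a , d , x∉p⇒x∈∁p a∉I , x∉p⇒x∈∁p (independent bd b∈I) ,
                       path₂-monitors girth ab bd (d≢a ∘ sym)

  ∁-independent-isMEGSet : GirthAtLeast G 5 → MinDegreeAtLeast G 2 →
                           ∀ {I} → Independent I → IsMEGSet G (∁ I)
  ∁-independent-isMEGSet girth δ≥2 {I} independent a b ab with a ∈? I | b ∈? I
  ... | yes a∈I | yes b∈I = contradiction b∈I (independent ab a∈I)
  ... | yes a∈I | no  b∉I =
    monitored-sym (edge-into-independent-monitored girth δ≥2 independent (Adj-sym ab) b∉I a∈I)
  ... | no  a∉I | yes b∈I = edge-into-independent-monitored girth δ≥2 independent ab a∉I b∈I
  ... | no  a∉I | no  b∉I = a , b , x∉p⇒x∈∁p a∉I , x∉p⇒x∈∁p b∉I , edge-monitors ab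

  fibre-independent : ∀ {k} {col : Fin n → Fin k} → (∀ u v → Adj u v → col u ≢ col v) →
                      ∀ c → Independent (fibre col c)
  fibre-independent {col = col} proper c uv u∈ v∈ =
    proper _ _ uv (trans (∈-fibre⁻ col u∈) (sym (∈-fibre⁻ col v∈)))

mainTheorem6 : ∀ {n : ℕ} (G : Graph n) → Connected G → GirthAtLeast G 5 →
    MinDegreeAtLeast G 2 → ∀ (χ : ℕ) → IsChromaticNumber G χ →
    Σ (Subset n) λ M → IsMEGSet G M × (∣ M ∣ * χ ≤ n * (χ ∸ 1))
mainTheorem6 {n} G _ girth δ≥2 zero ((col , _) , _) =
  ⊥ , (λ a _ _ → contradiction (col a) ¬Fin0) , subst (_≤ n * 0) (sym (*-zeroʳ ∣ ⊥ {n} ∣)) z≤n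
mainTheorem6 G _ girth δ≥2 (suc k) ((col , proper) , _) with ∃-small-∁fibre col
... | c , bound =
  ∁ (fibre col c) , ∁-independent-isMEGSet G girth δ≥2 (fibre-independent G proper c) , bound
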